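{- If $G$ is a $2$-connected graph, then its line graph $L(G)$ is prime.
   Context: All graphs are finite, simple and undirected. The line graph $L(G)$ has the edges of $G$ as vertices, two being adjacent when they share an endpoint. A connected graph is prime if it has no clique separator, i.e., no clique whose removal disconnects it. -}

module Defs where

open import Level using (0ℓ)
open import Data.Nat using (ℕ; _<_)
open import Data.Fin using (Fin) renaming (_<_ to _<ᶠ_)
open import Data.Bool using (Bool; true; false; T; not)
open import Data.Product using (Σ; Σ-syntax; _×_; _,_; proj₁; proj₂)
open import Data.Sum using (_⊎_)
open import Relation.Nullary using (¬_)
open import Relation.Binary.PropositionalEquality using (_≡_; _≢_)

record SimpleGraph (n : ℕ) : Set where
  field
    adj    : Fin n → Fin n → Bool
    sym    : ∀ x y → adj x y ≡ adj y x
    irrefl : ∀ x → adj x x ≡ false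

-- A general (simple, undirected) graph: a vertex type with an adjacency relation.
-- Used for line graphs, whose vertices are the edges of another graph.
record Graph : Set₁ where
  field
    V   : Set
    Adj : V → V → Set

toGraph : ∀ {n} → SimpleGraph n → Graph
toGraph {n} G = record { V = Fin n ; Adj = λ x y → T (SimpleGraph.adj G x y) }

module _ (G : Graph) where
  open Graph G

  Subset : Set
  Subset = V → Bool

  -- Walks from u to v all of whose vertices satisfy P (walks in the induced subgraph G[P]).
  data ReachIn (P : V → Set) : V → V → Set where
    here : ∀ {u} → P u → ReachIn P u u
    step : ∀ {u w v} → P u → Adj u w → ReachIn P w v → ReachIn P u v

  ConnectedIn : (V → Set) → Set
  ConnectedIn P = Σ V P × (∀ u v → P u → P v → ReachIn P u v)

  Connected : Set
  Connected = ConnectedIn (λ _ → Data.Unit.⊤)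
    where import Data.Unit

  IsClique : Subset → Set
  IsClique C = ∀ u v → T (C u) → T (C v) → u ≢ v → Adj u v

  Disconnects : Subset → Set
  Disconnects C = Σ V λ u → Σ V λ v →
    T (not (C u)) × T (not (C v)) × ¬ ReachIn (λ x → T (not (C x))) u v

  Prime : Set
  Prime = Connected × (∀ (C : Subset) → IsClique C → ¬ Disconnects C)

-- 2-connected (Diestel): more than 2 vertices, connected, and G − v connected for every vertex v.
TwoConnected : ∀ {n} → SimpleGraph n → Set
TwoConnected {n} G =
  2 < n × Connected (toGraph G) × (∀ (v : Fin n) → ConnectedIn (toGraph G) (λ u → u ≢ v))

Edge : ∀ {n} → SimpleGraph n → Set
Edge {n} G = Σ[ i ∈ Fin n ] Σ[ j ∈ Fin n ] (i <ᶠ j × T (SimpleGraph.adj G i j))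

end₁ end₂ : ∀ {n} (G : SimpleGraph n) → Edge G → Fin n
end₁ G e = proj₁ e
end₂ G e = proj₁ (proj₂ e)

LineGraph : ∀ {n} → SimpleGraph n → Graph
LineGraph {n} G = record
  { V   = Edge G
  ; Adj = λ e f →
      ¬ (end₁ G e ≡ end₁ G f × end₂ G e ≡ end₂ G f) ×
      (end₁ G e ≡ end₁ G f ⊎ end₁ G e ≡ end₂ G f ⊎ end₂ G e ≡ end₁ G f ⊎ end₂ G e ≡ end₂ G f)
  }

-- Two edges of G are adjacent in L(G) exactly when they share an end, so a clique C of L(G)
-- is a star at some vertex v or consists of edges of a triangle abc.  Let e, f be edges
-- outside C.  For every corner t of the triangle (or t = v), G − t is connected, and a path
-- in G − t from an end of e to an end of f uses no edge of C except possibly the side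
-- opposite t; so either e and f are joined in L(G) − C, or both reach an end of that side
-- through edges outside C.  If C separated e from f, the vertices reached from e and from f
-- would be disjoint, yet each set would meet every side of the triangle, which is impossible
-- for two disjoint sets and three corners.
module Submission where

open import Defs
open import Data.Nat using (ℕ; zero; suc; s≤s)
open import Data.Fin using (Fin; zero; suc)
open import Data.Fin.Properties using (<-cmp; <-irrelevant; <⇒≢) renaming (_≟_ to _≟ᶠ_)
open import Data.Bool using (true; false; T; not)
open import Data.Bool.Properties using (T-irrelevant)
open import Data.Unit using (tt)
open import Data.Empty using (⊥-elim)
open import Data.Product using (Σ-syntax; _×_; _,_; proj₁; proj₂; map₁)
open import Data.Sum as Sum using (_⊎_; inj₁; inj₂)
open import Effect.Monad using (RawMonad)
open import Level using (0ℓ)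
open import Relation.Nullary using (¬_; Dec; yes; no)
open import Relation.Nullary.Decidable.Core using (¬¬-excluded-middle; decidable-stable)
open import Relation.Nullary.Negation using (¬¬-Monad)
open import Relation.Unary using (_≬_)
open import Relation.Binary.Definitions using (tri<; tri≈; tri>)
open import Relation.Binary.PropositionalEquality using (_≡_; _≢_; refl; sym; trans; cong₂; subst)

open RawMonad (¬¬-Monad {a = 0ℓ}) using (return; _>>=_)

module _ {X : Set} (A B : X → Set) where

  MeetsBoth : X → X → Set
  MeetsBoth s r = (A s ⊎ A r) × (B s ⊎ B r)

  private
    meets-both-sides⇒≬ : ∀ {a s r} → A s → B r → MeetsBoth a s → MeetsBoth a r → A ≬ B
    meets-both-sides⇒≬ {s = s} As Br (_ , inj₂ Bs) _ = s , As , Bs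
    meets-both-sides⇒≬ {a} As Br (_ , inj₁ Ba) (inj₁ Aa , _) = a , Aa , Ba
    meets-both-sides⇒≬ {r = r} As Br (_ , inj₁ Ba) (inj₂ Ar , _) = r , Ar , Br

  meets-both-pairwise⇒≬ : ∀ {a b c} → MeetsBoth a b → MeetsBoth a c → MeetsBoth b c → A ≬ B
  meets-both-pairwise⇒≬ {b = b} _ _ (inj₁ Ab , inj₁ Bb) = b , Ab , Bb
  meets-both-pairwise⇒≬ ab ac (inj₁ Ab , inj₂ Bc) = meets-both-sides⇒≬ Ab Bc ab ac
  meets-both-pairwise⇒≬ ab ac (inj₂ Ac , inj₁ Bb) = meets-both-sides⇒≬ Ac Bb ac ab
  meets-both-pairwise⇒≬ {c = c} _ _ (inj₂ Ac , inj₂ Bc) = c , Ac , Bc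

module _ {n : ℕ} (G : SimpleGraph n) where
  open SimpleGraph G using (adj; irrefl)

  private
    V : Set
    V = Fin n
    E : Set
    E = Edge G
    GG : Graph
    GG = toGraph G
    LG : Graph
    LG = LineGraph G

  data _∈ₑ_ (x : V) (g : E) : Set where
    in₁ : end₁ G g ≡ x → x ∈ₑ g
    in₂ : end₂ G g ≡ x → x ∈ₑ g

  data Joins (g : E) (x y : V) : Set where
    forward  : end₁ G g ≡ x → end₂ G g ≡ y → Joins g x y
    backward : end₁ G g ≡ y → end₂ G g ≡ x → Joins g x y

  joins-sym : ∀ {g x y} → Joins g x y → Joins g y x
  joins-sym (forward p q)  = backward p q
  joins-sym (backward p q) = forward p q

  joins⇒∈ˡ : ∀ {g x y} → Joins g x y → x ∈ₑ g
  joins⇒∈ˡ (forward p _)  = in₁ p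
  joins⇒∈ˡ (backward _ q) = in₂ q

  joins⇒∈ʳ : ∀ {g x y} → Joins g x y → y ∈ₑ g
  joins⇒∈ʳ j = joins⇒∈ˡ (joins-sym j)

  ∈-joins : ∀ {g x y z} → Joins g x y → z ∈ₑ g → z ≡ x ⊎ z ≡ y
  ∈-joins (forward p _)  (in₁ r) = inj₁ (trans (sym r) p)
  ∈-joins (forward _ q)  (in₂ r) = inj₂ (trans (sym r) q)
  ∈-joins (backward p _) (in₁ r) = inj₂ (trans (sym r) p)
  ∈-joins (backward _ q) (in₂ r) = inj₁ (trans (sym r) q)

  end₁≢end₂ : (g : E) → end₁ G g ≢ end₂ G g
  end₁≢end₂ (_ , _ , i<j , _) = <⇒≢ i<j

  joins⇒≢ : ∀ {g x y} → Joins g x y → x ≢ y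
  joins⇒≢ {g} (forward p q)  x≡y = end₁≢end₂ g (trans p (trans x≡y (sym q)))
  joins⇒≢ {g} (backward p q) x≡y = end₁≢end₂ g (trans p (trans (sym x≡y) (sym q)))

  ∈-∈⇒joins : ∀ {g x y} → x ∈ₑ g → y ∈ₑ g → x ≢ y → Joins g x y
  ∈-∈⇒joins (in₁ p) (in₁ q) x≢y = ⊥-elim (x≢y (trans (sym p) q))
  ∈-∈⇒joins (in₁ p) (in₂ q) _   = forward p q
  ∈-∈⇒joins (in₂ p) (in₁ q) _   = backward q p
  ∈-∈⇒joins (in₂ p) (in₂ q) x≢y = ⊥-elim (x≢y (trans (sym p) q))

  other-end : ∀ {g x} → x ∈ₑ g → Σ[ y ∈ V ] Joins g x y
  other-end {g} (in₁ p) = end₂ G g , forward p refl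
  other-end {g} (in₂ p) = end₁ G g , backward refl p

  end-avoiding : (g : E) (v : V) → Σ[ x ∈ V ] x ∈ₑ g × x ≢ v
  end-avoiding g v with end₁ G g ≟ᶠ v
  ... | yes p = end₂ G g , in₂ refl , λ q → end₁≢end₂ g (trans p (sym q))
  ... | no ¬p = end₁ G g , in₁ refl , ¬p

  edge-ext : (g h : E) → end₁ G g ≡ end₁ G h → end₂ G g ≡ end₂ G h → g ≡ h
  edge-ext (i , j , i<j , t) (.i , .j , i<j′ , t′) refl refl =
    cong₂ (λ lt adjᵢⱼ → i , j , lt , adjᵢⱼ) (<-irrelevant i<j i<j′) (T-irrelevant t t′)

  _≟ₑ_ : (g h : E) → Dec (g ≡ h)
  g ≟ₑ h with end₁ G g ≟ᶠ end₁ G h | end₂ G g ≟ᶠ end₂ G h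
  ... | yes p | yes q = yes (edge-ext g h p q)
  ... | no ¬p | _     = no λ { refl → ¬p refl }
  ... | yes _ | no ¬q = no λ { refl → ¬q refl }

  _∈ₑ?_ : (x : V) (g : E) → Dec (x ∈ₑ g)
  x ∈ₑ? g with end₁ G g ≟ᶠ x | end₂ G g ≟ᶠ x
  ... | yes p | _     = yes (in₁ p)
  ... | no _  | yes q = yes (in₂ q)
  ... | no ¬p | no ¬q = no λ { (in₁ p) → ¬p p ; (in₂ q) → ¬q q }

  edge-joining : ∀ {x y} → T (adj x y) → Σ[ g ∈ E ] Joins g x y
  edge-joining {x} {y} xy with <-cmp x y
  ... | tri< x<y _ _ = (x , y , x<y , xy) , forward refl refl
  ... | tri≈ _ refl _ = ⊥-elim (subst T (irrefl x) xy)
  ... | tri> _ _ y<x = (y , x , y<x , subst T (SimpleGraph.sym G x y) xy) , backward refl refl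

  share⇒adjacent : ∀ {x} g h → x ∈ₑ g → x ∈ₑ h → g ≢ h → Graph.Adj LG g h
  share⇒adjacent g h x∈g x∈h g≢h = (λ (p , q) → g≢h (edge-ext g h p q)) , shared x∈g x∈h
    where
    shared : ∀ {x} → x ∈ₑ g → x ∈ₑ h →
             end₁ G g ≡ end₁ G h ⊎ end₁ G g ≡ end₂ G h ⊎ end₂ G g ≡ end₁ G h ⊎ end₂ G g ≡ end₂ G h
    shared (in₁ p) (in₁ q) = inj₁ (trans p (sym q))
    shared (in₁ p) (in₂ q) = inj₂ (inj₁ (trans p (sym q)))
    shared (in₂ p) (in₁ q) = inj₂ (inj₂ (inj₁ (trans p (sym q))))
    shared (in₂ p) (in₂ q) = inj₂ (inj₂ (inj₂ (trans p (sym q))))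

  adjacent⇒share : ∀ {g h} → Graph.Adj LG g h → Σ[ x ∈ V ] x ∈ₑ g × x ∈ₑ h
  adjacent⇒share {g} (_ , inj₁ p)               = end₁ G g , in₁ refl , in₁ (sym p)
  adjacent⇒share {g} (_ , inj₂ (inj₁ p))        = end₁ G g , in₁ refl , in₂ (sym p)
  adjacent⇒share {g} (_ , inj₂ (inj₂ (inj₁ p))) = end₂ G g , in₂ refl , in₁ (sym p)
  adjacent⇒share {g} (_ , inj₂ (inj₂ (inj₂ p))) = end₂ G g , in₂ refl , in₂ (sym p)

  reach-head : ∀ {P : V → Set} {x y} → ReachIn GG P x y → P x
  reach-head (here p)     = p
  reach-head (step p _ _) = p

  data Walk (P : E → Set) : V → V → Set where
    []   : ∀ {x} → Walk P x x
    cons : ∀ {x y z} (g : E) → P g → Joins g x y → Walk P y z → Walk P x z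

  module _ {P : E → Set} where

    _++_ : ∀ {x y z} → Walk P x y → Walk P y z → Walk P x z
    []            ++ w′ = w′
    cons g Pg j w ++ w′ = cons g Pg j (w ++ w′)

    reverse : ∀ {x y} → Walk P x y → Walk P y x
    reverse []              = []
    reverse (cons g Pg j w) = reverse w ++ cons g Pg (joins-sym j) []

    line-reach-via-shared : ∀ {x} e g {f} → P e → x ∈ₑ e → x ∈ₑ g →
                            ReachIn LG P g f → ReachIn LG P e f
    line-reach-via-shared e g Pe x∈e x∈g g↝f with e ≟ₑ g
    ... | yes refl = g↝f
    ... | no e≢g   = step Pe (share⇒adjacent e g x∈e x∈g e≢g) g↝f

    walk⇒line-reach : ∀ {x y} e f → Walk P x y → P e → P f → x ∈ₑ e → y ∈ₑ f →
                      ReachIn LG P e f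
    walk⇒line-reach e f [] Pe Pf x∈e y∈f = line-reach-via-shared e f Pe x∈e y∈f (here Pf)
    walk⇒line-reach e f (cons g Pg j w) Pe Pf x∈e y∈f =
      line-reach-via-shared e g Pe x∈e (joins⇒∈ˡ j) (walk⇒line-reach g f w Pg Pf (joins⇒∈ʳ j) y∈f)

    reach⇒walk : ∀ {Q : V → Set} → (∀ {x y} g → Q x → Q y → Joins g x y → P g) →
                 ∀ {x y} → ReachIn GG Q x y → Walk P x y
    reach⇒walk _ (here _) = []
    reach⇒walk P-on-Q (step Qx xw w↝y) with edge-joining xw
    ... | g , j = cons g (P-on-Q g Qx (reach-head w↝y) j) j (reach⇒walk P-on-Q w↝y)

  edge-on-reach : ∀ {Q : V → Set} {u v} → ReachIn GG Q u v → u ≢ v → E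
  edge-on-reach (here _)      u≢u = ⊥-elim (u≢u refl)
  edge-on-reach (step _ uw _) _   = proj₁ (edge-joining uw)

  line-graph-connected : Connected GG → ∀ {u v} → u ≢ v → Connected LG
  line-graph-connected (_ , conn) {u} {v} u≢v =
    (edge-on-reach (conn u v tt tt) u≢v , tt) ,
    λ e f _ _ → walk⇒line-reach e f (reach⇒walk (λ _ _ _ _ → tt) (conn (end₁ G e) (end₁ G f) tt tt))
                  tt tt (in₁ refl) (in₁ refl)

  module _ (C : Subset LG) where

    Free : E → Set
    Free g = T (not (C g))

    in-or-free : ∀ g → T (C g) ⊎ Free g
    in-or-free g with C g
    ... | true  = inj₁ tt
    ... | false = inj₂ tt

    Star : V → Set
    Star v = ∀ g → T (C g) → v ∈ₑ g

    OppositeEdge : V → V → V → Set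
    OppositeEdge t s r = ∀ g → T (C g) → ¬ t ∈ₑ g → Joins g s r

    -- The degenerate Triangle v v v says that C is a star at v.
    Triangle : V → V → V → Set
    Triangle a b c = OppositeEdge a b c × OppositeEdge b a c × OppositeEdge c a b

    star⇒triangle : ∀ {v} → Star v → Triangle v v v
    star⇒triangle {v} star = opposite , opposite , opposite
      where
      opposite : OppositeEdge v v v
      opposite g g∈C v∉g = ⊥-elim (v∉g (star g g∈C))

    star-or-missing : ∀ v → ¬ ¬ (Star v ⊎ Σ[ g ∈ E ] T (C g) × ¬ v ∈ₑ g)
    star-or-missing v = do
      no none ← ¬¬-excluded-middle
        where yes missing → return (inj₂ missing)
      return (inj₁ λ g g∈C → decidable-stable (v ∈ₑ? g) λ v∉g → none (g , g∈C , v∉g))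

    module _ (clique : IsClique LG C) where

      clique-other-end : ∀ {g h z w} → T (C g) → T (C h) → Joins h z w → ¬ z ∈ₑ g → w ∈ₑ g
      clique-other-end {g} {h} g∈C h∈C j z∉g with g ≟ₑ h
      ... | yes refl = ⊥-elim (z∉g (joins⇒∈ˡ j))
      ... | no g≢h with adjacent⇒share (clique g h g∈C h∈C g≢h)
      ...   | x , x∈g , x∈h with ∈-joins j x∈h
      ...     | inj₁ refl = ⊥-elim (z∉g x∈g)
      ...     | inj₂ refl = x∈g

      opposite-edge : ∀ {g h t s r} → T (C g) → Joins g t s → T (C h) → Joins h t r → s ≢ r →
                      OppositeEdge t s r
      opposite-edge g∈C ts h∈C tr s≢r m m∈C t∉m =
        ∈-∈⇒joins (clique-other-end m∈C g∈C ts t∉m) (clique-other-end m∈C h∈C tr t∉m) s≢r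

      triangle-of-clique-edges : ∀ {g h k a b c} → T (C g) → T (C h) → T (C k) →
                                 Joins g a b → Joins h b c → ¬ a ∈ₑ h → ¬ b ∈ₑ k → Triangle a b c
      triangle-of-clique-edges {a = a} {b} {c} g∈C h∈C k∈C ab bc a∉h b∉k =
        opposite-edge g∈C ab k∈C ac b≢c ,
        opposite-edge g∈C (joins-sym ab) h∈C bc a≢c ,
        opposite-edge k∈C (joins-sym ac) h∈C (joins-sym bc) (joins⇒≢ ab)
        where
        b≢c : b ≢ c
        b≢c = joins⇒≢ bc
        a≢c : a ≢ c
        a≢c refl = a∉h (joins⇒∈ʳ bc)
        ac : Joins _ a c
        ac = ∈-∈⇒joins (clique-other-end k∈C g∈C (joins-sym ab) b∉k)
                       (clique-other-end k∈C h∈C bc b∉k) a≢c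

      clique-in-triangle : V → ¬ ¬ (Σ[ a ∈ V ] Σ[ b ∈ V ] Σ[ c ∈ V ] Triangle a b c)
      clique-in-triangle v = do
        inj₂ (g , g∈C , _) ← star-or-missing v
          where inj₁ star → return (_ , _ , _ , star⇒triangle star)
        inj₂ (h , h∈C , a∉h) ← star-or-missing (end₁ G g)
          where inj₁ star → return (_ , _ , _ , star⇒triangle star)
        let ab = forward refl refl
            c , bc = other-end (clique-other-end h∈C g∈C ab a∉h)
        inj₂ (k , k∈C , b∉k) ← star-or-missing (end₂ G g)
          where inj₁ star → return (_ , _ , _ , star⇒triangle star)
        return (_ , _ , c , triangle-of-clique-edges g∈C h∈C k∈C ab bc a∉h b∉k)

    walk-into : ∀ {x y s r} → Walk Free y x → x ≡ s ⊎ x ≡ r → Walk Free y s ⊎ Walk Free y r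
    walk-into w (inj₁ refl) = inj₁ w
    walk-into w (inj₂ refl) = inj₂ w

    -- Only the edge sr of C can lie on a path of G − t.
    free-walk-or-opposite : ∀ {t s r} → OppositeEdge t s r → ∀ {x y} → ReachIn GG (_≢ t) x y →
      Walk Free x y ⊎ ((Walk Free x s ⊎ Walk Free x r) × (Walk Free y s ⊎ Walk Free y r))
    free-walk-or-opposite opposite (here _) = inj₁ []
    free-walk-or-opposite {t} {s} {r} opposite {x} {y} (step {w = w} x≢t xw w↝y)
      with edge-joining xw | free-walk-or-opposite opposite w↝y
    ... | g , j | rest with in-or-free g
    ...   | inj₂ g-free = Sum.map extend (map₁ (Sum.map extend extend)) rest
      where
      extend : ∀ {z} → Walk Free w z → Walk Free x z
      extend = cons g g-free j
    ...   | inj₁ g∈C = inj₂ (walk-into [] (∈-joins sr (joins⇒∈ˡ j)) , y-side rest)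
      where
      t∉g : ¬ t ∈ₑ g
      t∉g t∈g = Sum.[ (λ t≡x → x≢t (sym t≡x)) , (λ t≡w → reach-head w↝y (sym t≡w)) ] (∈-joins j t∈g)
      sr : Joins g s r
      sr = opposite g g∈C t∉g
      y-side : Walk Free w y ⊎ (Walk Free w s ⊎ Walk Free w r) × (Walk Free y s ⊎ Walk Free y r) →
               Walk Free y s ⊎ Walk Free y r
      y-side (inj₁ w↝y) = walk-into (reverse w↝y) (∈-joins sr (joins⇒∈ʳ j))
      y-side (inj₂ (_ , y↝sr)) = y↝sr

    module Separation (e f : E) (e-free : Free e) (f-free : Free f)
                      (e↮f : ¬ ReachIn LG Free e f) where

      Reaches : E → V → Set
      Reaches g z = Σ[ x ∈ V ] x ∈ₑ g × Walk Free x z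

      reaches-disjoint : ¬ (Reaches e ≬ Reaches f)
      reaches-disjoint (_ , (_ , x∈e , x↝z) , (_ , y∈f , y↝z)) =
        e↮f (walk⇒line-reach e f (x↝z ++ reverse y↝z) e-free f-free x∈e y∈f)

      meets-both : (∀ v → ConnectedIn GG (_≢ v)) → ∀ {t s r} → OppositeEdge t s r →
                   MeetsBoth (Reaches e) (Reaches f) s r
      meets-both cv {t} opposite with end-avoiding e t | end-avoiding f t
      ... | x , x∈e , x≢t | y , y∈f , y≢t
        with free-walk-or-opposite opposite (proj₂ (cv t) x y x≢t y≢t)
      ...   | inj₁ x↝y = ⊥-elim (e↮f (walk⇒line-reach e f x↝y e-free f-free x∈e y∈f))
      ...   | inj₂ (x↝sr , y↝sr) = reaches x∈e x↝sr , reaches y∈f y↝sr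
        where
        reaches : ∀ {g z s r} → z ∈ₑ g → Walk Free z s ⊎ Walk Free z r → Reaches g s ⊎ Reaches g r
        reaches z∈g = Sum.map (λ w → _ , z∈g , w) (λ w → _ , z∈g , w)

  no-clique-separator : (∀ v → ConnectedIn GG (_≢ v)) → ∀ C → IsClique LG C → ¬ Disconnects LG C
  no-clique-separator cv C clique (e , f , e-free , f-free , e↮f) =
    clique-in-triangle C clique (end₁ G e) λ (_ , _ , _ , opp-a , opp-b , opp-c) →
      reaches-disjoint (meets-both-pairwise⇒≬ _ _
        (meets-both cv opp-c) (meets-both cv opp-b) (meets-both cv opp-a))
    where open Separation C e f e-free f-free e↮f

lemma12 : ∀ {n : ℕ} (G : SimpleGraph n) → TwoConnected G → Prime (LineGraph G)
lemma12 {zero}        G (() , _)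
lemma12 {suc zero}    G (s≤s () , _)
lemma12 {suc (suc _)} G (_ , connected , connected-minus-vertex) =
  line-graph-connected G connected {zero} {suc zero} (λ ()) ,
  no-clique-separator G connected-minus-vertex
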